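{- Let $M$ be a matroid and $F\subseteq E(M)$ with $|F|=4$. Let $A_1,A_2,A_3,A_4$ be the four three-element subsets of $F$, and let $B_1,B_2,B_3$ be the three two-element subsets of $F$ not contained in $A_4$. Suppose there exist circuits $C_{A_4}$ and $C_{B_j}$ ($1\le j\le 3$) of $M$ and cocircuits $C^*_{A_i}$ ($1\le i\le 3$) of $M$ such that (i) $C^*_{A_i}\cap C_{B_j}=B_j$ for all $1\le i\le 3$, $1\le j\le 3$ with $B_j\subseteq A_i$, and (ii) $C^*_{A_i}\cap C_{A_4}=A_i\cap A_4$ for all $1\le i\le 3$. Then $M$ is non-weakly-orientable.
   Context: A signed subset of a finite set $E$ is a pair $Z=(Z^+,Z^-)$ of disjoint subsets of $E$; write $-Z=(Z^-,Z^+)$ and $\underline{Z}=Z^+\cup Z^-$. Two signed subsets $X,Y$ are orthogonal if $(X^+\cap Y^+)\cup(X^-\cap Y^-)\neq\varnothing \iff (X^+\cap Y^-)\cup(X^-\cap Y^+)\neq\varnothing$. A matroid $M$ is weakly-orientable if there exist collections $\mathscr{O},\mathscr{O}^*$ of signed subsets of $E(M)$ such that $-\mathscr{O}=\mathscr{O}$, $-\mathscr{O}^*=\mathscr{O}^*$, whenever $X,Z\in\mathscr{O}$ with $\underline{Z}\subseteq\underline{X}$ then $Z=\pm X$ (likewise for $\mathscr{O}^*$), $\{\underline{X}: X\in\mathscr{O}\}$ is the set of circuits of $M$, $\{\underline{Y}:Y\in\mathscr{O}^*\}$ is the set of cocircuits of $M$, and every $X\in\mathscr{O}$, $Y\in\mathscr{O}^*$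 with $|\underline{X}\cap\underline{Y}|=2$ are orthogonal. Non-weakly-orientable means not weakly-orientable. -}

module Defs where

open import Data.Nat using (ℕ)
open import Data.Fin using (Fin)
open import Data.Fin.Subset public
  using (Subset; _∈_; _∉_; _⊆_; _∩_; _∪_; ∣_∣; Nonempty; Empty)
  renaming (⊥ to ∅)
open import Data.Product using (Σ; ∃; _×_; _,_; proj₁; proj₂)
open import Data.Sum using (_⊎_)
open import Relation.Binary.PropositionalEquality using (_≡_; _≢_)
open import Relation.Nullary using (¬_)

record Matroid (n : ℕ) : Set₁ where
  field
    IsCircuit : Subset n → Set
    circ-nonempty : ¬ IsCircuit ∅
    circ-incomparable : ∀ {C D} → IsCircuit C → IsCircuit D → C ⊆ D → C ≡ D
    circ-elim : ∀ {C D e} → IsCircuit C → IsCircuit D → C ≢ D → e ∈ C → e ∈ D →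
                ∃ λ X → IsCircuit X × X ⊆ (C ∪ D) × e ∉ X

module _ {n : ℕ} (M : Matroid n) where
  open Matroid M

  Independent : Subset n → Set
  Independent I = ∀ C → IsCircuit C → ¬ (C ⊆ I)

  IsBasis : Subset n → Set
  IsBasis B = Independent B × (∀ I → Independent I → B ⊆ I → I ≡ B)

  -- dependent in the dual M* (bases of M* are complements of bases of M):
  -- D is not contained in E - B for any basis B, i.e. D meets every basis.
  DualDependent : Subset n → Set
  DualDependent D = ∀ B → IsBasis B → Nonempty (D ∩ B)

  -- cocircuit of M = circuit of M* = minimal dependent set of M*
  IsCocircuit : Subset n → Set
  IsCocircuit D = DualDependent D × (∀ D' → D' ⊆ D → DualDependent D' → D' ≡ D)

-- signed subsets of Fin n: pairs (Z⁺ , Z⁻); disjointness is a separate predicate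
SignedSubset : ℕ → Set
SignedSubset n = Subset n × Subset n

module _ {n : ℕ} where
  IsSigned : SignedSubset n → Set
  IsSigned (P , N) = Empty (P ∩ N)

  -_ : SignedSubset n → SignedSubset n
  - (P , N) = (N , P)

  underline : SignedSubset n → Subset n
  underline (P , N) = P ∪ N

  Orthogonal : SignedSubset n → SignedSubset n → Set
  Orthogonal (XP , XN) (YP , YN) =
    (Nonempty ((XP ∩ YP) ∪ (XN ∩ YN)) → Nonempty ((XP ∩ YN) ∪ (XN ∩ YP))) ×
    (Nonempty ((XP ∩ YN) ∪ (XN ∩ YP)) → Nonempty ((XP ∩ YP) ∪ (XN ∩ YN)))

  SignedCollection : (SignedSubset n → Set) → (Subset n → Set) → Set
  SignedCollection 𝒪 Circ =
    (∀ X → 𝒪 X → IsSigned X) ×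
    (∀ X → 𝒪 X → 𝒪 (- X)) ×
    (∀ X Z → 𝒪 X → 𝒪 Z → underline Z ⊆ underline X → (Z ≡ X ⊎ Z ≡ - X)) ×
    (∀ X → 𝒪 X → Circ (underline X)) ×
    (∀ C → Circ C → ∃ λ X → 𝒪 X × underline X ≡ C)

WeaklyOrientable : ∀ {n} → Matroid n → Set₁
WeaklyOrientable {n} M =
  Σ (SignedSubset n → Set) λ 𝒪 → Σ (SignedSubset n → Set) λ 𝒪* →
    SignedCollection 𝒪 (Matroid.IsCircuit M) ×
    SignedCollection 𝒪* (IsCocircuit M) ×
    (∀ X Y → 𝒪 X → 𝒪* Y → ∣ underline X ∩ underline Y ∣ ≡ 2 → Orthogonal X Y)

module Submission where

-- Write the sign of a signed set at e as a boolean (true iff e is positive) and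
-- Δ σ u v = σ u ⊕ σ v ("σ changes sign between u and v").  A circuit and a
-- cocircuit that are orthogonal and meet exactly in {u, v} change sign differently
-- between u and v.  Counting gives F = {d, e 0, e 1, e 2} with A₄ = F - d,
-- B j = {e j, d}, and for j ≢ j' an index i with B j, B j' ⊆ A i and
-- A i ∩ A₄ = {e j, e j'}.  Orthogonality of C*_{A i} with C_{A₄}, C_{B j} and
-- C_{B j'} then makes the potentials σ_X(e j) ⊕ Δ σ_{Z j} (e j) d (X, Z j signing
-- C_{A₄}, C_{B j}) pairwise distinct: three distinct booleans, a contradiction.

open import Defs
open import Data.Nat using (ℕ; zero; suc; _≤_; _<_)
import Data.Nat.Properties as ℕ
open import Data.Fin using (Fin; zero; suc; inject₁; fromℕ)
open import Data.Fin.Properties using (_≟_; any?; 0≢1+n; inject₁-injective; fromℕ≢inject₁)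
import Data.Fin.Properties as Fin
open import Data.Fin.Subset using (_-_; ⁅_⁆)
open import Data.Fin.Subset.Properties
  using (_∈?_; nonempty?; Empty-unique; ∣⊥∣≡0; ⊆-antisym; p⊆q⇒∣p∣≤∣q∣; p⊂q⇒∣p∣<∣q∣;
         p─⊥≡p; p─q⊆p; x∈p∧x≢y⇒x∈p-y; x∈p∩q⁺; x∈p∩q⁻; x∈p∪q⁺; x∈p∪q⁻; ∩-comm)
open import Data.Vec using (_∷_; lookup; here; there)
open import Data.Vec.Properties using ([]=⇒lookup; lookup⇒[]=)
open import Data.Bool using (Bool; true; false; not; _xor_)
open import Data.Bool.Properties
  using (¬-not; not-injective; xor-comm; xor-same; xor-identityʳ; xor-inverseˡ;
         xor-annihilates-not; xor-∧-commutativeRing)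
open import Algebra.Bundles using (CommutativeRing)
import Algebra.Properties.CommutativeSemigroup as CommutativeSemigroupProperties
open import Data.Product using (Σ; ∃; _×_; _,_; proj₁; proj₂)
open import Data.Sum using (_⊎_; inj₁; inj₂)
open import Data.Empty using (⊥)
open import Function using (_∘_)
open import Function.Definitions using (Injective)
open import Relation.Binary.PropositionalEquality
open import Relation.Nullary using (¬_; yes; no; ¬?)
open import Relation.Nullary.Decidable using (_×-dec_; decidable-stable)
open import Relation.Nullary.Negation using (contradiction)

open CommutativeSemigroupProperties
  (CommutativeRing.+-commutativeSemigroup xor-∧-commutativeRing)
  using () renaming (interchange to xor-interchange)

Δ : ∀ {A : Set} → (A → Bool) → A → A → Bool
Δ σ u v = σ u xor σ v

xor-cancelˡ : ∀ a {b c} → a xor b ≡ a xor c → b ≡ c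
xor-cancelˡ false eq = eq
xor-cancelˡ true  eq = not-injective eq

xor-telescope : ∀ a b s → (a xor s) xor (b xor s) ≡ a xor b
xor-telescope a b s = begin
  (a xor s) xor (b xor s)  ≡⟨ xor-interchange a s b s ⟩
  (a xor b) xor (s xor s)  ≡⟨ cong ((a xor b) xor_) (xor-same s) ⟩
  (a xor b) xor false      ≡⟨ xor-identityʳ (a xor b) ⟩
  a xor b                  ∎
  where open ≡-Reasoning

≢⇒xor≡true : ∀ {a b} → a ≢ b → a xor b ≡ true
≢⇒xor≡true {a} {b} a≢b = trans (cong (_xor b) (¬-not a≢b)) (xor-inverseˡ b)

xor≡true⇒≢ : ∀ {a b} → a xor b ≡ true → a ≢ b
xor≡true⇒≢ {a} eq refl with trans (sym (xor-same a)) eq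
... | ()

xor-≡-≢ : ∀ {a b c d} → a ≡ b → c ≢ d → a xor c ≢ b xor d
xor-≡-≢ {b = b} refl c≢d = c≢d ∘ xor-cancelˡ b

xor-≢-≡ : ∀ {a b c d} → a ≢ b → c ≡ d → a xor c ≢ b xor d
xor-≢-≡ {a} {b} {c} {d} a≢b c≡d eq =
  xor-≡-≢ c≡d a≢b (trans (xor-comm c a) (trans eq (xor-comm b d)))

no-three-distinct : ∀ {a b c : Bool} → a ≢ b → b ≢ c → a ≢ c → ⊥
no-three-distinct a≢b b≢c a≢c =
  a≢c (trans (¬-not a≢b) (sym (¬-not (b≢c ∘ sym))))

potentials-differ : ∀ {A : Set} (σX τ σZ σW : A → Bool) (x y d : A) →
  Δ σX x y ≢ Δ τ x y → Δ σZ x d ≢ Δ τ x d → Δ σW y d ≢ Δ τ y d →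
  σX x xor Δ σZ x d ≢ σX y xor Δ σW y d
potentials-differ σX τ σZ σW x y d Xxy Zxd Wyd = xor≡true⇒≢ (begin
  (σX x xor Qx) xor (σX y xor Qy)  ≡⟨ xor-interchange (σX x) Qx (σX y) Qy ⟩
  Δ σX x y xor (Qx xor Qy)          ≡⟨ cong (Δ σX x y xor_) τ-telescopes ⟩
  Δ σX x y xor Δ τ x y              ≡⟨ ≢⇒xor≡true Xxy ⟩
  true                              ∎)
  where
  open ≡-Reasoning
  Qx = Δ σZ x d
  Qy = Δ σW y d
  -- τ changes between x and y exactly when Qx ⊕ Qy, as Δ τ x d = ¬ Qx, Δ τ y d = ¬ Qy.
  τ-telescopes : Qx xor Qy ≡ Δ τ x y
  τ-telescopes = begin
    Qx xor Qy                  ≡⟨ sym (xor-annihilates-not Qx Qy) ⟩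
    not Qx xor not Qy          ≡⟨ sym (cong₂ _xor_ (¬-not (Zxd ∘ sym)) (¬-not (Wyd ∘ sym))) ⟩
    Δ τ x d xor Δ τ y d        ≡⟨ xor-telescope (τ x) (τ y) (τ d) ⟩
    Δ τ x y                    ∎

size-remove : ∀ {n} (p : Subset n) {x : Fin n} → x ∈ p → ∣ p ∣ ≡ suc ∣ p - x ∣
size-remove (true  ∷ p) {zero}  here        = cong (suc ∘ ∣_∣) (sym (p─⊥≡p p))
size-remove (true  ∷ p) {suc x} (there x∈p) = cong suc (size-remove p x∈p)
size-remove (false ∷ p) {suc x} (there x∈p) = size-remove p x∈p

∉-remove : ∀ {n} (p : Subset n) (x : Fin n) → x ∉ p - x
∉-remove (s ∷ p) (suc x) (there x∈p-x) = ∉-remove p x x∈p-x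

module _ {n : ℕ} where

  ∈-remove⁻ : ∀ {p : Subset n} {x y} → y ∈ p - x → y ∈ p × y ≢ x
  ∈-remove⁻ {p} {x} y∈ = p─q⊆p p ⁅ x ⁆ y∈ , λ { refl → ∉-remove p x y∈ }

  size-remove₂ : ∀ {p : Subset n} {u v} → u ≢ v → u ∈ p → v ∈ p →
    ∣ p ∣ ≡ suc (suc ∣ p - u - v ∣)
  size-remove₂ {p} {u} u≢v u∈p v∈p =
    trans (size-remove p u∈p) (cong suc (size-remove (p - u) (x∈p∧x≢y⇒x∈p-y v∈p (u≢v ∘ sym))))

  size-0⇒∉ : ∀ {p : Subset n} {x} → ∣ p ∣ ≡ 0 → x ∉ p
  size-0⇒∉ {p} size x∈p with trans (sym size) (size-remove p x∈p)
  ... | ()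

  size-suc⇒member : ∀ {p : Subset n} {k} → ∣ p ∣ ≡ suc k → Nonempty p
  size-suc⇒member {p} size with nonempty? p
  ... | yes p≠∅ = p≠∅
  ... | no  p=∅ with trans (sym size) (trans (cong ∣_∣ (Empty-unique p=∅)) (∣⊥∣≡0 n))
  ... | ()

  smaller⇒outside : ∀ {p q : Subset n} → ∣ p ∣ < ∣ q ∣ → ∃ λ x → x ∈ q × x ∉ p
  smaller⇒outside {p} {q} p<q with any? (λ x → x ∈? q ×-dec ¬? (x ∈? p))
  ... | yes found = found
  ... | no  none  = contradiction (p⊆q⇒∣p∣≤∣q∣ q⊆p) (ℕ.<⇒≱ p<q)
    where
    q⊆p : q ⊆ p
    q⊆p {x} x∈q = decidable-stable (x ∈? p) (λ x∉p → none (x , x∈q , x∉p))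

  subset-of-same-size : ∀ {p q : Subset n} → p ⊆ q → ∣ q ∣ ≤ ∣ p ∣ → p ≡ q
  subset-of-same-size {p} {q} p⊆q q≤p = ⊆-antisym p⊆q q⊆p
    where
    q⊆p : q ⊆ p
    q⊆p {x} x∈q = decidable-stable (x ∈? p)
      (λ x∉p → ℕ.<⇒≱ (p⊂q⇒∣p∣<∣q∣ (p⊆q , x , x∈q , x∉p)) q≤p)

  remove-point-of-size : ∀ {p q : Subset n} → p ⊆ q → ∣ q ∣ ≡ suc ∣ p ∣ →
    ∃ λ r → r ∈ q × p ≡ q - r
  remove-point-of-size {p} {q} p⊆q size with smaller⇒outside {p} {q} (ℕ.≤-reflexive (sym size))
  ... | r , r∈q , r∉p = r , r∈q , subset-of-same-size p⊆q-r (ℕ.≤-reflexive size-q-r)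
    where
    p⊆q-r : p ⊆ q - r
    p⊆q-r x∈p = x∈p∧x≢y⇒x∈p-y (p⊆q x∈p) (λ { refl → r∉p x∈p })
    size-q-r : ∣ q - r ∣ ≡ ∣ p ∣
    size-q-r = ℕ.suc-injective (trans (sym (size-remove q r∈q)) size)

  size-2⇒pair : ∀ {S : Subset n} {u v e} → ∣ S ∣ ≡ 2 → u ≢ v → u ∈ S → v ∈ S →
    e ∈ S → e ≡ u ⊎ e ≡ v
  size-2⇒pair {S} {u} {v} {e} size u≢v u∈S v∈S e∈S with e ≟ u | e ≟ v
  ... | yes e≡u | _       = inj₁ e≡u
  ... | no  _   | yes e≡v = inj₂ e≡v
  ... | no  e≢u | no  e≢v =
    contradiction (x∈p∧x≢y⇒x∈p-y (x∈p∧x≢y⇒x∈p-y e∈S e≢u) e≢v) (size-0⇒∉ size-S-u-v)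
    where
    size-S-u-v : ∣ S - u - v ∣ ≡ 0
    size-S-u-v = sym (ℕ.suc-injective (ℕ.suc-injective
      (trans (sym size) (size-remove₂ u≢v u∈S v∈S))))

  remove-∩ : ∀ (p : Subset n) x y → (p - x) ∩ (p - y) ≡ p - x - y
  remove-∩ p x y = ⊆-antisym to from
    where
    to : (p - x) ∩ (p - y) ⊆ p - x - y
    to e∈ with x∈p∩q⁻ (p - x) (p - y) e∈
    ... | e∈p-x , e∈p-y = x∈p∧x≢y⇒x∈p-y e∈p-x (proj₂ (∈-remove⁻ e∈p-y))
    from : p - x - y ⊆ (p - x) ∩ (p - y)
    from e∈ with ∈-remove⁻ e∈
    ... | e∈p-x , e≢y = x∈p∩q⁺ (e∈p-x , x∈p∧x≢y⇒x∈p-y (proj₁ (∈-remove⁻ e∈p-x)) e≢y)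

injection-onto : ∀ {n} k (S : Subset n) → ∣ S ∣ ≡ k → (g : Fin k → Fin n) →
  Injective _≡_ _≡_ g → (∀ i → g i ∈ S) → ∀ {y} → y ∈ S → ∃ λ i → g i ≡ y
injection-onto zero    S size g g-inj g∈S y∈S = contradiction y∈S (size-0⇒∉ size)
injection-onto (suc k) S size g g-inj g∈S {y} y∈S with y ≟ g zero
... | yes y≡g₀ = zero , sym y≡g₀
... | no  y≢g₀ with injection-onto k (S - g zero) size-rest (g ∘ suc)
                      (Fin.suc-injective ∘ g-inj) g-rest (x∈p∧x≢y⇒x∈p-y y∈S y≢g₀)
  where
  size-rest : ∣ S - g zero ∣ ≡ k
  size-rest = ℕ.suc-injective (trans (sym (size-remove S (g∈S zero))) size)
  g-rest : ∀ i → g (suc i) ∈ S - g zero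
  g-rest i = x∈p∧x≢y⇒x∈p-y (g∈S (suc i)) (λ eq → 0≢1+n (g-inj (sym eq)))
... | i , gi≡y = suc i , gi≡y

module _ {n : ℕ} where

  sign : SignedSubset n → Fin n → Bool
  sign (P , _) e = lookup P e

  SameSign OppositeSign : SignedSubset n → SignedSubset n → Subset n
  SameSign     (XP , XN) (YP , YN) = (XP ∩ YP) ∪ (XN ∩ YN)
  OppositeSign (XP , XN) (YP , YN) = (XP ∩ YN) ∪ (XN ∩ YP)

  private
    true-false-differ : ∀ {a b : Bool} → a ≡ true → b ≡ false → a ≢ b
    true-false-differ refl refl ()

  sign-positive : ∀ {P N : Subset n} {e} → e ∈ P → sign (P , N) e ≡ true
  sign-positive = []=⇒lookup

  sign-negative : ∀ {P N : Subset n} {e} → IsSigned (P , N) → e ∈ N → sign (P , N) e ≡ false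
  sign-negative {P} {N} {e} signed e∈N with lookup P e in eq
  ... | false = refl
  ... | true  = contradiction (e , x∈p∩q⁺ (lookup⇒[]= e P eq , e∈N)) signed

  agree-on-same : ∀ {X Y : SignedSubset n} {e} → IsSigned X → IsSigned Y →
    e ∈ SameSign X Y → sign X e ≡ sign Y e
  agree-on-same {XP , XN} {YP , YN} sX sY e∈ with x∈p∪q⁻ (XP ∩ YP) (XN ∩ YN) e∈
  ... | inj₁ e∈PP with x∈p∩q⁻ XP YP e∈PP
  ...   | e∈XP , e∈YP = trans (sign-positive {N = XN} e∈XP) (sym (sign-positive {N = YN} e∈YP))
  agree-on-same {XP , XN} {YP , YN} sX sY e∈ | inj₂ e∈NN with x∈p∩q⁻ XN YN e∈NN
  ...   | e∈XN , e∈YN = trans (sign-negative sX e∈XN) (sym (sign-negative sY e∈YN))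

  disagree-on-opposite : ∀ {X Y : SignedSubset n} {e} → IsSigned X → IsSigned Y →
    e ∈ OppositeSign X Y → sign X e ≢ sign Y e
  disagree-on-opposite {XP , XN} {YP , YN} sX sY e∈ with x∈p∪q⁻ (XP ∩ YN) (XN ∩ YP) e∈
  ... | inj₁ e∈PN with x∈p∩q⁻ XP YN e∈PN
  ...   | e∈XP , e∈YN = true-false-differ (sign-positive {N = XN} e∈XP) (sign-negative sY e∈YN)
  disagree-on-opposite {XP , XN} {YP , YN} sX sY e∈ | inj₂ e∈NP with x∈p∩q⁻ XN YP e∈NP
  ...   | e∈XN , e∈YP = true-false-differ (sign-positive {N = YN} e∈YP) (sign-negative sX e∈XN) ∘ sym

  common-split : ∀ {X Y : SignedSubset n} {e} → e ∈ underline X ∩ underline Y →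
    e ∈ SameSign X Y ⊎ e ∈ OppositeSign X Y
  common-split {XP , XN} {YP , YN} e∈ with x∈p∩q⁻ (XP ∪ XN) (YP ∪ YN) e∈
  ... | e∈X , e∈Y with x∈p∪q⁻ XP XN e∈X | x∈p∪q⁻ YP YN e∈Y
  ... | inj₁ e∈XP | inj₁ e∈YP = inj₁ (x∈p∪q⁺ (inj₁ (x∈p∩q⁺ (e∈XP , e∈YP))))
  ... | inj₂ e∈XN | inj₂ e∈YN = inj₁ (x∈p∪q⁺ (inj₂ (x∈p∩q⁺ (e∈XN , e∈YN))))
  ... | inj₁ e∈XP | inj₂ e∈YN = inj₂ (x∈p∪q⁺ (inj₁ (x∈p∩q⁺ (e∈XP , e∈YN))))
  ... | inj₂ e∈XN | inj₁ e∈YP = inj₂ (x∈p∪q⁺ (inj₂ (x∈p∩q⁺ (e∈XN , e∈YP))))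

  common-join : ∀ {X Y : SignedSubset n} {e} → e ∈ SameSign X Y ⊎ e ∈ OppositeSign X Y →
    e ∈ underline X ∩ underline Y
  common-join {XP , XN} {YP , YN} (inj₁ e∈) with x∈p∪q⁻ (XP ∩ YP) (XN ∩ YN) e∈
  ... | inj₁ e∈PP = let (e∈XP , e∈YP) = x∈p∩q⁻ XP YP e∈PP in
                    x∈p∩q⁺ (x∈p∪q⁺ (inj₁ e∈XP) , x∈p∪q⁺ (inj₁ e∈YP))
  ... | inj₂ e∈NN = let (e∈XN , e∈YN) = x∈p∩q⁻ XN YN e∈NN in
                    x∈p∩q⁺ (x∈p∪q⁺ (inj₂ e∈XN) , x∈p∪q⁺ (inj₂ e∈YN))
  common-join {XP , XN} {YP , YN} (inj₂ e∈) with x∈p∪q⁻ (XP ∩ YN) (XN ∩ YP) e∈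
  ... | inj₁ e∈PN = let (e∈XP , e∈YN) = x∈p∩q⁻ XP YN e∈PN in
                    x∈p∩q⁺ (x∈p∪q⁺ (inj₁ e∈XP) , x∈p∪q⁺ (inj₂ e∈YN))
  ... | inj₂ e∈NP = let (e∈XN , e∈YP) = x∈p∩q⁻ XN YP e∈NP in
                    x∈p∩q⁺ (x∈p∪q⁺ (inj₂ e∈XN) , x∈p∪q⁺ (inj₁ e∈YP))

  -- Orthogonal signed sets meeting only in u and v agree in sign at exactly one
  -- of u, v; hence exactly one of them changes sign between u and v.
  orthogonal⇒Δ-differ : ∀ {X Y : SignedSubset n} {u v} → IsSigned X → IsSigned Y →
    Orthogonal X Y → (∀ {e} → e ∈ underline X ∩ underline Y → e ≡ u ⊎ e ≡ v) →
    u ∈ underline X ∩ underline Y → Δ (sign X) u v ≢ Δ (sign Y) u v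
  orthogonal⇒Δ-differ {X} {Y} sX sY (same⇒opposite , opposite⇒same) only-uv u∈
    with common-split {X} {Y} u∈
  ... | inj₁ u-same with same⇒opposite (_ , u-same)
  ...   | w , w-opp with only-uv (common-join {X} {Y} (inj₂ w-opp))
  ...     | inj₁ refl = contradiction (agree-on-same sX sY u-same) (disagree-on-opposite sX sY w-opp)
  ...     | inj₂ refl = xor-≡-≢ (agree-on-same sX sY u-same) (disagree-on-opposite sX sY w-opp)
  orthogonal⇒Δ-differ {X} {Y} sX sY (same⇒opposite , opposite⇒same) only-uv u∈
    | inj₂ u-opp with opposite⇒same (_ , u-opp)
  ...   | w , w-same with only-uv (common-join {X} {Y} (inj₁ w-same))
  ...     | inj₁ refl = contradiction (agree-on-same sX sY w-same) (disagree-on-opposite sX sY u-opp)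
  ...     | inj₂ refl = xor-≢-≡ (disagree-on-opposite sX sY u-opp) (agree-on-same sX sY w-same)

signing : ∀ {n} {𝒪 : SignedSubset n → Set} {P : Subset n → Set} → SignedCollection 𝒪 P →
  ∀ {C} → P C → Σ (SignedSubset n) λ X → 𝒪 X × underline X ≡ C
signing (_ , _ , _ , _ , onto) {C} C∈P = onto C C∈P

signed : ∀ {n} {𝒪 : SignedSubset n → Set} {P : Subset n → Set} → SignedCollection 𝒪 P →
  ∀ {X} → 𝒪 X → IsSigned X
signed (is-signed , _) {X} = is-signed X

-- Counting shows F = {d, e 0, e 1, e 2} with A₄ = F - d, B j = {e j, d}, and
-- each A (inject₁ i) equal to F minus a point r i ≢ d.
module Configuration {n : ℕ} (F : Subset n) (size-F : ∣ F ∣ ≡ 4)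
  (A : Fin 4 → Subset n) (A-inj : Injective _≡_ _≡_ A)
  (A⊆F : ∀ k → A k ⊆ F) (size-A : ∀ k → ∣ A k ∣ ≡ 3)
  (B : Fin 3 → Subset n) (B-inj : Injective _≡_ _≡_ B)
  (B⊆F : ∀ j → B j ⊆ F) (size-B : ∀ j → ∣ B j ∣ ≡ 2) (B⊈A₄ : ∀ j → ¬ (B j ⊆ A (fromℕ 3)))
  where

  A₄ : Subset n
  A₄ = A (fromℕ 3)

  removed-point : ∀ k → ∃ λ r → r ∈ F × A k ≡ F - r
  removed-point k = remove-point-of-size (A⊆F k) (trans size-F (cong suc (sym (size-A k))))

  d : Fin n
  d = proj₁ (removed-point (fromℕ 3))

  d∈F : d ∈ F
  d∈F = proj₁ (proj₂ (removed-point (fromℕ 3)))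

  A₄≡F-d : A₄ ≡ F - d
  A₄≡F-d = proj₂ (proj₂ (removed-point (fromℕ 3)))

  r : Fin 3 → Fin n
  r i = proj₁ (removed-point (inject₁ i))

  r∈F : ∀ i → r i ∈ F
  r∈F i = proj₁ (proj₂ (removed-point (inject₁ i)))

  A≡F-r : ∀ i → A (inject₁ i) ≡ F - r i
  A≡F-r i = proj₂ (proj₂ (removed-point (inject₁ i)))

  r-injective : Injective _≡_ _≡_ r
  r-injective {i} {i'} ri≡ri' = inject₁-injective (A-inj (begin
    A (inject₁ i)   ≡⟨ A≡F-r i ⟩
    F - r i         ≡⟨ cong (λ x → F - x) ri≡ri' ⟩
    F - r i'        ≡⟨ sym (A≡F-r i') ⟩
    A (inject₁ i')  ∎))
    where open ≡-Reasoning

  -- r i = d would make A (inject₁ i) = A₄.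
  r≢d : ∀ i → r i ≢ d
  r≢d i ri≡d = fromℕ≢inject₁ (A-inj (begin
    A₄              ≡⟨ A₄≡F-d ⟩
    F - d           ≡⟨ cong (λ x → F - x) (sym ri≡d) ⟩
    F - r i         ≡⟨ sym (A≡F-r i) ⟩
    A (inject₁ i)   ∎))
    where open ≡-Reasoning

  size-F-d : ∣ F - d ∣ ≡ 3
  size-F-d = ℕ.suc-injective (trans (sym (size-remove F d∈F)) size-F)

  r-onto : ∀ {z} → z ∈ F - d → ∃ λ i → r i ≡ z
  r-onto = injection-onto 3 (F - d) size-F-d r r-injective
             (λ i → x∈p∧x≢y⇒x∈p-y (r∈F i) (r≢d i))

  -- d lies in every B j, since otherwise B j ⊆ F - d = A₄.
  d∈B : ∀ j → d ∈ B j
  d∈B j = decidable-stable (d ∈? B j) λ d∉B → B⊈A₄ j λ {w} w∈B →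
    subst (w ∈_) (sym A₄≡F-d) (x∈p∧x≢y⇒x∈p-y (B⊆F j w∈B) λ { refl → d∉B w∈B })

  other-point : ∀ j → Nonempty (B j - d)
  other-point j = size-suc⇒member
    (ℕ.suc-injective (trans (sym (size-remove (B j) (d∈B j))) (size-B j)))

  e : Fin 3 → Fin n
  e j = proj₁ (other-point j)

  e∈B : ∀ j → e j ∈ B j
  e∈B j = proj₁ (∈-remove⁻ (proj₂ (other-point j)))

  e≢d : ∀ j → e j ≢ d
  e≢d j = proj₂ (∈-remove⁻ (proj₂ (other-point j)))

  e∈F-d : ∀ j → e j ∈ F - d
  e∈F-d j = x∈p∧x≢y⇒x∈p-y (B⊆F j (e∈B j)) (e≢d j)

  -- Since B j = {e j, d}, any set containing e j and d contains B j.
  B⊆ : ∀ j {T} → e j ∈ T → d ∈ T → B j ⊆ T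
  B⊆ j e∈T d∈T w∈B with size-2⇒pair (size-B j) (e≢d j) (e∈B j) (d∈B j) w∈B
  ... | inj₁ refl = e∈T
  ... | inj₂ refl = d∈T

  e-distinct : ∀ {j j'} → j ≢ j' → e j ≢ e j'
  e-distinct {j} {j'} j≢j' ej≡ej' = j≢j' (B-inj (⊆-antisym
    (B⊆ j  (subst (_∈ B j') (sym ej≡ej') (e∈B j')) (d∈B j'))
    (B⊆ j' (subst (_∈ B j) ej≡ej' (e∈B j)) (d∈B j))))

  record Cover (j j' : Fin 3) : Set where
    field
      i         : Fin 3
      B⊆A       : B j ⊆ A (inject₁ i)
      B'⊆A      : B j' ⊆ A (inject₁ i)
      size-A∩A₄ : ∣ A (inject₁ i) ∩ A₄ ∣ ≡ 2
      e∈A∩A₄    : e j ∈ A (inject₁ i) ∩ A₄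
      e'∈A∩A₄   : e j' ∈ A (inject₁ i) ∩ A₄

  -- The index is the one removing the fourth point z of F - {d, e j, e j'}.
  cover : ∀ {j j'} → j ≢ j' → Cover j j'
  cover {j} {j'} j≢j' = record
    { i         = i
    ; B⊆A       = B⊆ j  (in-A (e∈F j)  (z≢e ∘ sym)) (in-A d∈F (z≢d ∘ sym))
    ; B'⊆A      = B⊆ j' (in-A (e∈F j') (z≢e' ∘ sym)) (in-A d∈F (z≢d ∘ sym))
    ; size-A∩A₄ = trans (cong ∣_∣ A∩A₄≡F-z-d) size-F-z-d
    ; e∈A∩A₄    = in-A∩A₄ (e∈F j)  (z≢e ∘ sym)  (e≢d j)
    ; e'∈A∩A₄   = in-A∩A₄ (e∈F j') (z≢e' ∘ sym) (e≢d j')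
    }
    where
    e∈F : ∀ k → e k ∈ F
    e∈F k = B⊆F k (e∈B k)

    fourth : Nonempty (F - d - e j - e j')
    fourth = size-suc⇒member (ℕ.suc-injective (ℕ.suc-injective
      (trans (sym (size-remove₂ (e-distinct j≢j') (e∈F-d j) (e∈F-d j'))) size-F-d)))

    z : Fin n
    z = proj₁ fourth
    z∈F-d-e : z ∈ F - d - e j
    z∈F-d-e = proj₁ (∈-remove⁻ (proj₂ fourth))
    z≢e' : z ≢ e j'
    z≢e' = proj₂ (∈-remove⁻ (proj₂ fourth))
    z∈F-d : z ∈ F - d
    z∈F-d = proj₁ (∈-remove⁻ z∈F-d-e)
    z≢e : z ≢ e j
    z≢e = proj₂ (∈-remove⁻ z∈F-d-e)
    z∈F : z ∈ F
    z∈F = proj₁ (∈-remove⁻ z∈F-d)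
    z≢d : z ≢ d
    z≢d = proj₂ (∈-remove⁻ z∈F-d)

    i : Fin 3
    i = proj₁ (r-onto z∈F-d)
    A≡F-z : A (inject₁ i) ≡ F - z
    A≡F-z = trans (A≡F-r i) (cong (λ x → F - x) (proj₂ (r-onto z∈F-d)))

    in-A : ∀ {w} → w ∈ F → w ≢ z → w ∈ A (inject₁ i)
    in-A {w} w∈F w≢z = subst (w ∈_) (sym A≡F-z) (x∈p∧x≢y⇒x∈p-y w∈F w≢z)

    A∩A₄≡F-z-d : A (inject₁ i) ∩ A₄ ≡ F - z - d
    A∩A₄≡F-z-d = trans (cong₂ _∩_ A≡F-z A₄≡F-d) (remove-∩ F z d)

    size-F-z-d : ∣ F - z - d ∣ ≡ 2
    size-F-z-d = ℕ.suc-injective (ℕ.suc-injective (trans (sym (size-remove₂ z≢d z∈F d∈F)) size-F))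

    in-A∩A₄ : ∀ {w} → w ∈ F → w ≢ z → w ≢ d → w ∈ A (inject₁ i) ∩ A₄
    in-A∩A₄ {w} w∈F w≢z w≢d =
      subst (w ∈_) (sym A∩A₄≡F-z-d) (x∈p∧x≢y⇒x∈p-y (x∈p∧x≢y⇒x∈p-y w∈F w≢z) w≢d)

  -- The sign argument, for a matroid M with the circuits C₄ = C_{A₄}, C j = C_{B j}
  -- and cocircuits C* i = C*_{A i} of the statement, and a weak orientation of M.
  module Obstruction (M : Matroid n) (C₄ : Subset n) (C C* : Fin 3 → Subset n)
    (C₄-circuit : Matroid.IsCircuit M C₄) (C-circuit : ∀ j → Matroid.IsCircuit M (C j))
    (C*-cocircuit : ∀ i → IsCocircuit M (C* i))
    (meet-B : ∀ i j → B j ⊆ A (inject₁ i) → C* i ∩ C j ≡ B j)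
    (meet-A : ∀ i → C* i ∩ C₄ ≡ A (inject₁ i) ∩ A₄)
    {𝒪 𝒪* : SignedSubset n → Set}
    (𝒪-signs : SignedCollection 𝒪 (Matroid.IsCircuit M))
    (𝒪*-signs : SignedCollection 𝒪* (IsCocircuit M))
    (orth : ∀ X Y → 𝒪 X → 𝒪* Y → ∣ underline X ∩ underline Y ∣ ≡ 2 → Orthogonal X Y)
    where

    circuit-cocircuit-Δ : ∀ {P Q S u v} → 𝒪 P → 𝒪* Q → underline P ∩ underline Q ≡ S →
      ∣ S ∣ ≡ 2 → u ≢ v → u ∈ S → v ∈ S → Δ (sign P) u v ≢ Δ (sign Q) u v
    circuit-cocircuit-Δ {P} {Q} P∈𝒪 Q∈𝒪* refl size u≢v u∈S v∈S =
      orthogonal⇒Δ-differ (signed 𝒪-signs P∈𝒪) (signed 𝒪*-signs Q∈𝒪*)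
        (orth P Q P∈𝒪 Q∈𝒪* size) (size-2⇒pair size u≢v u∈S v∈S) u∈S

    X : SignedSubset n
    X = proj₁ (signing 𝒪-signs C₄-circuit)

    X∈𝒪 : 𝒪 X
    X∈𝒪 = proj₁ (proj₂ (signing 𝒪-signs C₄-circuit))

    underline-X : underline X ≡ C₄
    underline-X = proj₂ (proj₂ (signing 𝒪-signs C₄-circuit))

    Y : Fin 3 → SignedSubset n
    Y i = proj₁ (signing 𝒪*-signs (C*-cocircuit i))

    Y∈𝒪* : ∀ i → 𝒪* (Y i)
    Y∈𝒪* i = proj₁ (proj₂ (signing 𝒪*-signs (C*-cocircuit i)))

    underline-Y : ∀ i → underline (Y i) ≡ C* i
    underline-Y i = proj₂ (proj₂ (signing 𝒪*-signs (C*-cocircuit i)))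

    Z : Fin 3 → SignedSubset n
    Z j = proj₁ (signing 𝒪-signs (C-circuit j))

    Z∈𝒪 : ∀ j → 𝒪 (Z j)
    Z∈𝒪 j = proj₁ (proj₂ (signing 𝒪-signs (C-circuit j)))

    underline-Z : ∀ j → underline (Z j) ≡ C j
    underline-Z j = proj₂ (proj₂ (signing 𝒪-signs (C-circuit j)))

    potential : Fin 3 → Bool
    potential j = sign X (e j) xor Δ (sign (Z j)) (e j) d

    -- Distinct indices have distinct potentials: orthogonality of Y i with X on
    -- {e j, e j'}, with Z j on {e j, d} and with Z j' on {e j', d}.
    potential-distinct : ∀ j j' → j ≢ j' → potential j ≢ potential j'
    potential-distinct j j' j≢j' =
      potentials-differ (sign X) (sign (Y i)) (sign (Z j)) (sign (Z j')) (e j) (e j') d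
        (circuit-cocircuit-Δ X∈𝒪 (Y∈𝒪* i) X∩Y≡A∩A₄ size-A∩A₄ (e-distinct j≢j') e∈A∩A₄ e'∈A∩A₄)
        (circuit-cocircuit-Δ (Z∈𝒪 j)  (Y∈𝒪* i) (Z∩Y≡B j  B⊆A)  (size-B j)  (e≢d j)  (e∈B j)  (d∈B j))
        (circuit-cocircuit-Δ (Z∈𝒪 j') (Y∈𝒪* i) (Z∩Y≡B j' B'⊆A) (size-B j') (e≢d j') (e∈B j') (d∈B j'))
      where
      open Cover (cover j≢j')
      X∩Y≡A∩A₄ : underline X ∩ underline (Y i) ≡ A (inject₁ i) ∩ A₄
      X∩Y≡A∩A₄ = trans (cong₂ _∩_ underline-X (underline-Y i))
                       (trans (∩-comm C₄ (C* i)) (meet-A i))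
      Z∩Y≡B : ∀ k → B k ⊆ A (inject₁ i) → underline (Z k) ∩ underline (Y i) ≡ B k
      Z∩Y≡B k B⊆A = trans (cong₂ _∩_ (underline-Z k) (underline-Y i))
                          (trans (∩-comm (C k) (C* i)) (meet-B i k B⊆A))

lemma4p1 : ∀ {n : ℕ} (M : Matroid n) (F : Subset n) → ∣ F ∣ ≡ 4 →
    (A : Fin 4 → Subset n) → Injective _≡_ _≡_ A →
    (∀ i → A i ⊆ F) → (∀ i → ∣ A i ∣ ≡ 3) →
    (B : Fin 3 → Subset n) → Injective _≡_ _≡_ B →
    (∀ j → B j ⊆ F) → (∀ j → ∣ B j ∣ ≡ 2) → (∀ j → ¬ (B j ⊆ A (fromℕ 3))) →
    Σ (Subset n) (λ CA4 → Σ (Fin 3 → Subset n) λ CB → Σ (Fin 3 → Subset n) λ CA* →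
      Matroid.IsCircuit M CA4 × (∀ j → Matroid.IsCircuit M (CB j)) ×
      (∀ i → IsCocircuit M (CA* i)) ×
      (∀ i j → B j ⊆ A (inject₁ i) → CA* i ∩ CB j ≡ B j) ×
      (∀ i → CA* i ∩ CA4 ≡ A (inject₁ i) ∩ A (fromℕ 3))) →
    ¬ WeaklyOrientable M
lemma4p1 M F size-F A A-inj A⊆F size-A B B-inj B⊆F size-B B⊈A₄
  (C₄ , C , C* , C₄-circuit , C-circuit , C*-cocircuit , meet-B , meet-A)
  (𝒪 , 𝒪* , 𝒪-signs , 𝒪*-signs , orth) =
  -- potential : Fin 3 → Bool would be injective.
  no-three-distinct (potential-distinct zero (suc zero) λ ())
                    (potential-distinct (suc zero) (suc (suc zero)) λ ())
                    (potential-distinct zero (suc (suc zero)) λ ())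
  where
  open Configuration F size-F A A-inj A⊆F size-A B B-inj B⊆F size-B B⊈A₄
  open Obstruction M C₄ C C* C₄-circuit C-circuit C*-cocircuit meet-B meet-A
                   𝒪-signs 𝒪*-signs orth
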